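{- Let $c\in\mathbb{C}$ with $c\neq 1$. Let $P(\Delta)=\dfrac{\log(1+\Delta)}{c(1+\Delta)-1}$, regarded as a formal power series $P(\Delta)=\sum_{k\ge0}p_k\Delta^k$ in $\Delta$. Then, as an identity of power series in $t$ (convergent near $t=0$), $$\frac{t}{1-c\,e^{ -t}}=\sum_{n=0}^{\infty}\frac{(-t)^n}{n!}\,P(\Delta)\,0^n,\qquad P(\Delta)\,0^n:=\sum_{k=0}^{n}p_k\,\Delta^k0^n .$$ Equivalently, for the Todd operator $\mathrm{Todd}(c,\partial_h)=\dfrac{\partial_h}{1-c\,e^{ -\partial_h}}$, one has the operator identity $\mathrm{Todd}(c,\partial_h)=\dfrac{\log(1+\Delta)}{c(1+\Delta)-1}\,e^{ -0\cdot\partial_h}$ in the umbral sense that the coefficient of $\partial_h^n$ is $\frac{(-1)^n}{n!}P(\Delta)0^n$.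
   Context: $\Delta$ is the forward difference operator $\Delta f(x)=f(x+1)-f(x)$, and $\Delta^k0^n$ denotes $(\Delta^k f)(0)$ for $f(x)=x^n$ (with $0^0=1$); $\Delta^k0^n=0$ for $k>n$. The notation $e^{ -0\cdot t}$ stands for the umbral series $\sum_n (-t)^n 0^n/n!$ on which an operator in $\Delta$ acts term by term. -}

module Defs where

open import Level using (Level)
open import Data.Nat as ℕ using (ℕ; zero; suc; _∸_)
open import Data.Integer as ℤ using (ℤ; +_; -[1+_])
open import Data.List using (List; []; _∷_)
open import Algebra.Bundles using (CommutativeRing)

Δ : (ℕ → ℤ) → (ℕ → ℤ)
Δ f x = f (suc x) ℤ.- f x

Δ^ : ℕ → (ℕ → ℤ) → (ℕ → ℤ)
Δ^ zero    f = f
Δ^ (suc k) f = Δ (Δ^ k f)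

-- Δ^k 0^n := (Δ^k f)(0) for f(x) = x^n  (ℕ._^_ has 0^0 = 1)
Δ^k0^n : ℕ → ℕ → ℤ
Δ^k0^n k n = Δ^ k (λ x → + (x ℕ.^ n)) 0

module Series {a ℓ : Level} (R : CommutativeRing a ℓ) where
  open CommutativeRing R

  PowerSeries : Set a
  PowerSeries = ℕ → Carrier

  fromℕ : ℕ → Carrier
  fromℕ zero    = 0#
  fromℕ (suc n) = 1# + fromℕ n

  fromℤ : ℤ → Carrier
  fromℤ (+ n)      = fromℕ n
  fromℤ -[1+ n ]   = - fromℕ (suc n)

  sign : ℕ → Carrier
  sign zero    = 1#
  sign (suc n) = - sign n

  sumTo : ℕ → (ℕ → Carrier) → Carrier
  sumTo zero    f = f 0
  sumTo (suc n) f = sumTo n f + f (suc n)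

  _⋆_ : PowerSeries → PowerSeries → PowerSeries
  (f ⋆ g) n = sumTo n (λ i → f i * g (n ∸ i))

  X : PowerSeries
  X (suc zero) = 1#
  X _          = 0#

  -- Multiplicative inverse of a power series f, given an inverse u of
  -- its constant term f 0:  g 0 = u,  g (n+1) = − u · Σ_{j=0}^{n} f (j+1) g (n−j).
  module Inverse (u : Carrier) (f : PowerSeries) where
    dot : ℕ → List Carrier → Carrier
    dot j []       = 0#
    dot j (x ∷ xs) = f (suc j) * x + dot (suc j) xs

    -- prefix n = g n ∷ g (n−1) ∷ … ∷ g 0
    prefix : ℕ → List Carrier
    prefix zero    = u ∷ []
    prefix (suc n) = (- (u * dot 0 (prefix n))) ∷ prefix n

    headOr0 : List Carrier → Carrier
    headOr0 []      = 0#
    headOr0 (x ∷ _) = x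

    inv : PowerSeries
    inv n = headOr0 (prefix n)

  invSeries : Carrier → PowerSeries → PowerSeries
  invSeries u f = Inverse.inv u f

  -- The data of the theorem.  c ∈ R, u = (1 − c)⁻¹, and
  -- ι n = (n+1)⁻¹ in R (so R is a ℚ-algebra).

  module Todd (c u : Carrier) (ι : ℕ → Carrier) where

    invFact : ℕ → Carrier
    invFact zero    = 1#
    invFact (suc n) = invFact n * ι n

    expNeg : PowerSeries
    expNeg m = sign m * invFact m

    toddDen : PowerSeries
    toddDen zero    = 1# - c
    toddDen (suc m) = - (c * expNeg (suc m))

    toddSeries : PowerSeries
    toddSeries = X ⋆ invSeries u toddDen

    logSeries : PowerSeries
    logSeries zero    = 0#
    logSeries (suc k) = sign k * ι k

    -- c(1+Δ) − 1 = (c − 1) + c Δ ; its constant term c − 1 has inverse −u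
    pDen : PowerSeries
    pDen zero          = c - 1#
    pDen (suc zero)    = c
    pDen (suc (suc _)) = 0#

    p : PowerSeries
    p = logSeries ⋆ invSeries (- u) pDen

    P0^n : ℕ → Carrier
    P0^n n = sumTo n (λ k → p k * fromℤ (Δ^k0^n k n))

    rhsSeries : PowerSeries
    rhsSeries n = sign n * invFact n * P0^n n

-- Let F_k = umbral k = Σₙ (−t)ⁿ/n! · Δᵏ0ⁿ, the value at x = 0 of Δᵏ e^{−xt}. Since
-- e^{−t} e^{−xt} = e^{−(x+1)t} = (1 + Δ) e^{−xt}, multiplication by e^{−t} acts on the F_k as
-- 1 + Δ. Hence S = Σₖ pₖ F_k satisfies (1 − c e^{−t}) S = −Σₖ [(c(1+Δ) − 1) P(Δ)]ₖ F_k
-- = −Σₖ [log(1+Δ)]ₖ F_k, and Newton's series log(1+Δ) xⁿ|₀ = (d/dx) xⁿ|₀ turns this into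
-- −(−t) = t. As 1 − c is a unit, t/(1 − c e^{−t}) is the only series with this property.

module Submission where

open import Defs
open import Level using (Level)
open import Data.Nat as ℕ using (ℕ; suc; zero; _∸_; _≤_; _<_; z≤n; s≤s)
open import Algebra.Bundles using (CommutativeRing; CommutativeSemiring)
import Data.Nat.Properties as ℕ
open import Data.Integer as ℤ using (ℤ; +_; -[1+_])
import Data.Integer.Properties as ℤ
import Data.Sign as Sign
open import Data.Maybe using (Maybe; just; nothing)
open import Data.Sum using (inj₁; inj₂)
open import Data.Nat.Induction using (<-rec)
open import Relation.Nullary using (yes; no)
open import Relation.Binary.PropositionalEquality as ≡ using (_≡_)
open import Algebra.Solver.Ring.AlmostCommutativeRing
  using (fromCommutativeRing; _-Raw-AlmostCommutative⟶_)
import Algebra.Solver.Ring as RingSolver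
import Algebra.Properties.Ring as RingProperties
import Algebra.Properties.Group as GroupProperties
import Algebra.Properties.Semiring.Mult as SemiringMult
import Algebra.Definitions.RawSemiring as RawSemiringDefinitions

module Arithmetic {a ℓ} (R : CommutativeRing a ℓ) where
  open CommutativeRing R
  open Series R
  open RingProperties ring public
    using (-‿involutive; -‿distribˡ-*; -‿distribʳ-*; -0#≈0#; -‿+-comm)
  open GroupProperties +-group public using () renaming (∙-cancelʳ to +-cancelʳ)
  open SemiringMult semiring using (_×_; ×-homo-+; ×1-homo-*)
  open import Relation.Binary.Reasoning.Setoid setoid public

  fromℕ≈×1# : ∀ n → fromℕ n ≈ n × 1#
  fromℕ≈×1# zero    = refl
  fromℕ≈×1# (suc n) = +-congˡ (fromℕ≈×1# n)

  fromℕ-+ : ∀ m n → fromℕ (m ℕ.+ n) ≈ fromℕ m + fromℕ n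
  fromℕ-+ m n = begin
    fromℕ (m ℕ.+ n)        ≈⟨ fromℕ≈×1# (m ℕ.+ n) ⟩
    (m ℕ.+ n) × 1#         ≈⟨ ×-homo-+ 1# m n ⟩
    m × 1# + n × 1#        ≈⟨ sym (+-cong (fromℕ≈×1# m) (fromℕ≈×1# n)) ⟩
    fromℕ m + fromℕ n      ∎

  fromℕ-* : ∀ m n → fromℕ (m ℕ.* n) ≈ fromℕ m * fromℕ n
  fromℕ-* m n = begin
    fromℕ (m ℕ.* n)        ≈⟨ fromℕ≈×1# (m ℕ.* n) ⟩
    (m ℕ.* n) × 1#         ≈⟨ ×1-homo-* m n ⟩
    (m × 1#) * (n × 1#)    ≈⟨ sym (*-cong (fromℕ≈×1# m) (fromℕ≈×1# n)) ⟩
    fromℕ m * fromℕ n      ∎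

  fromℤ-⊖ : ∀ m n → fromℤ (m ℤ.⊖ n) ≈ fromℕ m - fromℕ n
  fromℤ-⊖ m zero = begin
    fromℤ (m ℤ.⊖ 0)  ≡⟨ ≡.cong fromℤ (ℤ.⊖-≥ {m} z≤n) ⟩
    fromℕ m          ≈⟨ sym (trans (+-congˡ -0#≈0#) (+-identityʳ _)) ⟩
    fromℕ m - 0#     ∎
  fromℤ-⊖ zero    (suc n) = sym (+-identityˡ _)
  fromℤ-⊖ (suc m) (suc n) = begin
    fromℤ (suc m ℤ.⊖ suc n)          ≡⟨ ≡.cong fromℤ (ℤ.[1+m]⊖[1+n]≡m⊖n m n) ⟩
    fromℤ (m ℤ.⊖ n)                  ≈⟨ fromℤ-⊖ m n ⟩
    fromℕ m - fromℕ n                   ≈⟨ +-congˡ (sym (+-identityˡ _)) ⟩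
    fromℕ m + (0# - fromℕ n)            ≈⟨ +-congˡ (+-congʳ (sym (-‿inverseʳ 1#))) ⟩
    fromℕ m + ((1# - 1#) - fromℕ n)     ≈⟨ +-congˡ (+-assoc _ _ _) ⟩
    fromℕ m + (1# + (- 1# - fromℕ n))   ≈⟨ sym (+-assoc _ _ _) ⟩
    (fromℕ m + 1#) + (- 1# - fromℕ n)   ≈⟨ +-cong (+-comm _ _) (-‿+-comm 1# (fromℕ n)) ⟩
    (1# + fromℕ m) - (1# + fromℕ n)  ∎

  fromℤ-neg : ∀ i → fromℤ (ℤ.- i) ≈ - fromℤ i
  fromℤ-neg (+ zero)  = sym -0#≈0#
  fromℤ-neg (+ suc n) = refl
  fromℤ-neg -[1+ n ]  = sym (-‿involutive _)

  fromℤ-+ : ∀ i j → fromℤ (i ℤ.+ j) ≈ fromℤ i + fromℤ j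
  fromℤ-+ (+ m)    (+ n)    = fromℕ-+ m n
  fromℤ-+ (+ m)    -[1+ n ] = fromℤ-⊖ m (suc n)
  fromℤ-+ -[1+ m ] (+ n)    = trans (fromℤ-⊖ n (suc m)) (+-comm _ _)
  fromℤ-+ -[1+ m ] -[1+ n ] = begin
    - (1# + (1# + fromℕ (m ℕ.+ n)))      ≈⟨ -‿cong (+-congˡ (+-congˡ (fromℕ-+ m n))) ⟩
    - (1# + (1# + (fromℕ m + fromℕ n)))  ≈⟨ -‿cong (+-congˡ (sym (+-assoc _ _ _))) ⟩
    - (1# + ((1# + fromℕ m) + fromℕ n))  ≈⟨ -‿cong (+-congˡ (+-congʳ (+-comm _ _))) ⟩
    - (1# + ((fromℕ m + 1#) + fromℕ n))  ≈⟨ -‿cong (trans (+-congˡ (+-assoc _ _ _)) (sym (+-assoc _ _ _))) ⟩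
    - ((1# + fromℕ m) + (1# + fromℕ n))  ≈⟨ sym (-‿+-comm _ _) ⟩
    - (1# + fromℕ m) - (1# + fromℕ n)    ∎

  fromℤ-+◃ : ∀ n → fromℤ (Sign.+ ℤ.◃ n) ≈ fromℕ n
  fromℤ-+◃ zero    = refl
  fromℤ-+◃ (suc n) = refl

  fromℤ--◃ : ∀ n → fromℤ (Sign.- ℤ.◃ n) ≈ - fromℕ n
  fromℤ--◃ zero    = sym -0#≈0#
  fromℤ--◃ (suc n) = refl

  fromℤ-* : ∀ i j → fromℤ (i ℤ.* j) ≈ fromℤ i * fromℤ j
  fromℤ-* (+ m) (+ n) = trans (fromℤ-+◃ (m ℕ.* n)) (fromℕ-* m n)
  fromℤ-* (+ m) -[1+ n ] = begin
    fromℤ (Sign.- ℤ.◃ (m ℕ.* suc n))  ≈⟨ fromℤ--◃ (m ℕ.* suc n) ⟩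
    - fromℕ (m ℕ.* suc n)             ≈⟨ -‿cong (fromℕ-* m (suc n)) ⟩
    - (fromℕ m * fromℕ (suc n))       ≈⟨ -‿distribʳ-* _ _ ⟩
    fromℕ m * - fromℕ (suc n)         ∎
  fromℤ-* -[1+ m ] (+ n) = begin
    fromℤ (Sign.- ℤ.◃ (suc m ℕ.* n))  ≈⟨ fromℤ--◃ (suc m ℕ.* n) ⟩
    - fromℕ (suc m ℕ.* n)             ≈⟨ -‿cong (fromℕ-* (suc m) n) ⟩
    - (fromℕ (suc m) * fromℕ n)       ≈⟨ -‿distribˡ-* _ _ ⟩
    - fromℕ (suc m) * fromℕ n         ∎
  fromℤ-* -[1+ m ] -[1+ n ] = begin
    fromℕ (suc m ℕ.* suc n)                ≈⟨ fromℕ-* (suc m) (suc n) ⟩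
    fromℕ (suc m) * fromℕ (suc n)          ≈⟨ sym (-‿involutive _) ⟩
    - - (fromℕ (suc m) * fromℕ (suc n))    ≈⟨ -‿cong (-‿distribˡ-* _ _) ⟩
    - (- fromℕ (suc m) * fromℕ (suc n))    ≈⟨ -‿distribʳ-* _ _ ⟩
    - fromℕ (suc m) * - fromℕ (suc n)      ∎

  private
    ring′ = fromCommutativeRing R

    fromℤ-homomorphism : ℤ.+-*-rawRing -Raw-AlmostCommutative⟶ ring′
    fromℤ-homomorphism = record
      { ⟦_⟧ = fromℤ ; +-homo = fromℤ-+ ; *-homo = fromℤ-* ; -‿homo = fromℤ-neg
      ; 0-homo = refl ; 1-homo = +-identityʳ 1# }

    fromℤ-≟ : ∀ i j → Maybe (fromℤ i ≈ fromℤ j)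
    fromℤ-≟ i j with i ℤ.≟ j
    ... | yes ≡.refl = just refl
    ... | no _       = nothing

  open RingSolver ℤ.+-*-rawRing ring′ fromℤ-homomorphism fromℤ-≟ public
    using (solve; _:=_; _:+_; _:*_; :-_; _:-_)

  unit-cancelˡ : ∀ {v d x y} → v * d ≈ 1# → d * x ≈ d * y → x ≈ y
  unit-cancelˡ {v} {d} {x} {y} vd≈1 dx≈dy = begin
    x             ≈⟨ sym (trans (*-congʳ vd≈1) (*-identityˡ x)) ⟩
    (v * d) * x   ≈⟨ *-assoc v d x ⟩
    v * (d * x)   ≈⟨ *-congˡ dx≈dy ⟩
    v * (d * y)   ≈⟨ sym (*-assoc v d y) ⟩
    (v * d) * y   ≈⟨ trans (*-congʳ vd≈1) (*-identityˡ y) ⟩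
    y             ∎

module Sums {a ℓ} (R : CommutativeRing a ℓ) where
  open CommutativeRing R hiding (zero)
  open Series R
  open Arithmetic R

  sumTo-cong : ∀ n {f g : ℕ → Carrier} → (∀ i → f i ≈ g i) → sumTo n f ≈ sumTo n g
  sumTo-cong zero    f≈g = f≈g 0
  sumTo-cong (suc n) f≈g = +-cong (sumTo-cong n f≈g) (f≈g (suc n))

  sumTo-cong-≤ : ∀ n {f g : ℕ → Carrier} → (∀ i → i ≤ n → f i ≈ g i) → sumTo n f ≈ sumTo n g
  sumTo-cong-≤ zero    f≈g = f≈g 0 z≤n
  sumTo-cong-≤ (suc n) f≈g =
    +-cong (sumTo-cong-≤ n (λ i i≤n → f≈g i (ℕ.m≤n⇒m≤1+n i≤n))) (f≈g (suc n) ℕ.≤-refl)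

  sumTo-+ : ∀ n (f g : ℕ → Carrier) → sumTo n (λ i → f i + g i) ≈ sumTo n f + sumTo n g
  sumTo-+ zero    f g = refl
  sumTo-+ (suc n) f g = begin
    sumTo n (λ i → f i + g i) + (f (suc n) + g (suc n))  ≈⟨ +-congʳ (sumTo-+ n f g) ⟩
    (sumTo n f + sumTo n g) + (f (suc n) + g (suc n))    ≈⟨ solve 4 (λ a b c d → (a :+ b) :+ (c :+ d) := (a :+ c) :+ (b :+ d))
                                                               refl _ _ _ _ ⟩
    (sumTo n f + f (suc n)) + (sumTo n g + g (suc n))    ∎

  *-distribˡ-sumTo : ∀ n (x : Carrier) (f : ℕ → Carrier) → x * sumTo n f ≈ sumTo n (λ i → x * f i)
  *-distribˡ-sumTo zero    x f = refl
  *-distribˡ-sumTo (suc n) x f = trans (distribˡ _ _ _) (+-congʳ (*-distribˡ-sumTo n x f))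

  sumTo-zero : ∀ n (f : ℕ → Carrier) → (∀ i → f i ≈ 0#) → sumTo n f ≈ 0#
  sumTo-zero zero    f f≈0 = f≈0 0
  sumTo-zero (suc n) f f≈0 = trans (+-cong (sumTo-zero n f f≈0) (f≈0 (suc n))) (+-identityˡ _)

  sumTo-unfoldˡ : ∀ n (f : ℕ → Carrier) → sumTo (suc n) f ≈ f 0 + sumTo n (λ i → f (suc i))
  sumTo-unfoldˡ zero    f = refl
  sumTo-unfoldˡ (suc n) f = trans (+-congʳ (sumTo-unfoldˡ n f)) (+-assoc _ _ _)

  sumTo-extend : ∀ m n (f : ℕ → Carrier) → m ≤ n → (∀ i → m < i → f i ≈ 0#) → sumTo m f ≈ sumTo n f
  sumTo-extend m zero    f z≤n f≈0 = refl
  sumTo-extend m (suc n) f m≤1+n f≈0 with ℕ.m≤n⇒m<n∨m≡n m≤1+n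
  ... | inj₂ ≡.refl     = refl
  ... | inj₁ (s≤s m≤n) =
    trans (sym (+-identityʳ _)) (+-cong (sumTo-extend m n f m≤n f≈0) (sym (f≈0 (suc n) (s≤s m≤n))))

  sumTo-suc-∸ : ∀ n (G : ℕ → ℕ → Carrier) →
    sumTo (suc n) (λ i → G i (suc n ∸ i)) ≈ sumTo n (λ i → G i (suc (n ∸ i))) + G (suc n) 0
  sumTo-suc-∸ n G = +-cong
    (sumTo-cong-≤ n (λ i i≤n → reflexive (≡.cong (G i) (ℕ.+-∸-assoc 1 i≤n))))
    (reflexive (≡.cong (G (suc n)) (ℕ.n∸n≡0 n)))

  sumTo-swap : ∀ m n (A : ℕ → ℕ → Carrier) →
               sumTo m (λ i → sumTo n (A i)) ≈ sumTo n (λ k → sumTo m (λ i → A i k))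
  sumTo-swap zero    n A = refl
  sumTo-swap (suc m) n A = begin
    sumTo m (λ i → sumTo n (A i)) + sumTo n (A (suc m))            ≈⟨ +-congʳ (sumTo-swap m n A) ⟩
    sumTo n (λ k → sumTo m (λ i → A i k)) + sumTo n (A (suc m))    ≈⟨ sym (sumTo-+ n _ _) ⟩
    sumTo n (λ k → sumTo m (λ i → A i k) + A (suc m) k)            ∎

  sumTo-alternating-telescope : ∀ n (A : ℕ → Carrier) →
    sumTo n (λ k → sign k * (A (suc k) + A k)) ≈ A 0 + sign n * A (suc n)
  sumTo-alternating-telescope zero A = begin
    1# * (A 1 + A 0)   ≈⟨ *-identityˡ _ ⟩
    A 1 + A 0          ≈⟨ +-comm _ _ ⟩
    A 0 + A 1          ≈⟨ +-congˡ (sym (*-identityˡ _)) ⟩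
    A 0 + 1# * A 1     ∎
  sumTo-alternating-telescope (suc n) A = trans (+-congʳ (sumTo-alternating-telescope n A))
    (solve 4 (λ a s b c → (a :+ s :* b) :+ (:- s) :* (c :+ b) := a :+ (:- s) :* c) refl _ _ _ _)

module PowerSeriesAlgebra {a ℓ} (R : CommutativeRing a ℓ) where
  open CommutativeRing R hiding (zero)
  open Series R
  open Arithmetic R
  open Sums R

  one : PowerSeries
  one zero    = 1#
  one (suc _) = 0#

  shift : PowerSeries → PowerSeries
  shift f zero    = 0#
  shift f (suc k) = f k

  ⋆-congˡ : ∀ {f g : PowerSeries} (h : PowerSeries) → (∀ i → f i ≈ g i) → ∀ n → (f ⋆ h) n ≈ (g ⋆ h) n
  ⋆-congˡ h f≈g n = sumTo-cong n (λ i → *-congʳ (f≈g i))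

  ⋆-congʳ : ∀ (f : PowerSeries) {g h : PowerSeries} → (∀ i → g i ≈ h i) → ∀ n → (f ⋆ g) n ≈ (f ⋆ h) n
  ⋆-congʳ f g≈h n = sumTo-cong n (λ i → *-congˡ (g≈h (n ∸ i)))

  ⋆-shift : ∀ (f g : PowerSeries) n → (f ⋆ shift g) n ≈ shift (f ⋆ g) n
  ⋆-shift f g zero    = zeroʳ _
  ⋆-shift f g (suc n) = begin
    (f ⋆ shift g) (suc n)                          ≈⟨ sumTo-suc-∸ n (λ i j → f i * shift g j) ⟩
    (f ⋆ g) n + f (suc n) * 0#                     ≈⟨ trans (+-congˡ (zeroʳ _)) (+-identityʳ _) ⟩
    (f ⋆ g) n                                      ∎

  ⋆-identityʳ : ∀ (f : PowerSeries) n → (f ⋆ one) n ≈ f n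
  ⋆-identityʳ f zero    = *-identityʳ _
  ⋆-identityʳ f (suc n) = begin
    (f ⋆ one) (suc n)                              ≈⟨ sumTo-suc-∸ n (λ i j → f i * one j) ⟩
    sumTo n (λ i → f i * 0#) + f (suc n) * 1#      ≈⟨ +-cong (sumTo-zero n _ (λ i → zeroʳ _)) (*-identityʳ _) ⟩
    0# + f (suc n)                                 ≈⟨ +-identityˡ _ ⟩
    f (suc n)                                      ∎

  ⋆-identityˡ : ∀ (f : PowerSeries) n → (one ⋆ f) n ≈ f n
  ⋆-identityˡ f zero    = *-identityˡ _
  ⋆-identityˡ f (suc n) = begin
    (one ⋆ f) (suc n)                              ≈⟨ sumTo-unfoldˡ n _ ⟩
    1# * f (suc n) + sumTo n (λ i → 0# * f (n ∸ i)) ≈⟨ +-cong (*-identityˡ _) (sumTo-zero n _ (λ i → zeroˡ _)) ⟩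
    f (suc n) + 0#                                 ≈⟨ +-identityʳ _ ⟩
    f (suc n)                                      ∎

  ⋆-*ˡ : ∀ (f g : PowerSeries) x n → ((λ j → x * f j) ⋆ g) n ≈ x * (f ⋆ g) n
  ⋆-*ˡ f g x n = trans (sumTo-cong n (λ i → *-assoc _ _ _)) (sym (*-distribˡ-sumTo n x _))

  ⋆-*ʳ : ∀ (f g : PowerSeries) x n → (f ⋆ (λ j → x * g j)) n ≈ x * (f ⋆ g) n
  ⋆-*ʳ f g x n = trans (sumTo-cong n (λ i → solve 3 (λ F X G → F :* (X :* G) := X :* (F :* G)) refl _ _ _))
                       (sym (*-distribˡ-sumTo n x _))

  ⋆-linearˡ : ∀ (f g h : PowerSeries) (x y : Carrier) n →
              ((λ j → x * g j + y * h j) ⋆ f) n ≈ x * (g ⋆ f) n + y * (h ⋆ f) n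
  ⋆-linearˡ f g h x y n = begin
    sumTo n (λ i → (x * g i + y * h i) * f (n ∸ i))
      ≈⟨ sumTo-cong n (λ i → distribʳ _ _ _) ⟩
    sumTo n (λ i → x * g i * f (n ∸ i) + y * h i * f (n ∸ i))  ≈⟨ sumTo-+ n _ _ ⟩
    ((λ j → x * g j) ⋆ f) n + ((λ j → y * h j) ⋆ f) n         ≈⟨ +-cong (⋆-*ˡ g f x n) (⋆-*ˡ h f y n) ⟩
    x * (g ⋆ f) n + y * (h ⋆ f) n                              ∎

  ⋆-linearʳ : ∀ (f g h : PowerSeries) (x y : Carrier) n →
              (f ⋆ (λ j → x * g j + y * h j)) n ≈ x * (f ⋆ g) n + y * (f ⋆ h) n
  ⋆-linearʳ f g h x y n = begin
    sumTo n (λ i → f i * (x * g (n ∸ i) + y * h (n ∸ i)))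
      ≈⟨ sumTo-cong n (λ i → distribˡ _ _ _) ⟩
    sumTo n (λ i → f i * (x * g (n ∸ i)) + f i * (y * h (n ∸ i)))  ≈⟨ sumTo-+ n _ _ ⟩
    (f ⋆ (λ j → x * g j)) n + (f ⋆ (λ j → y * h j)) n             ≈⟨ +-cong (⋆-*ʳ f g x n) (⋆-*ʳ f h y n) ⟩
    x * (f ⋆ g) n + y * (f ⋆ h) n                                  ∎

  module _ (v : Carrier) (f : PowerSeries) where
    open Inverse v f

    dot-prefix : ∀ m j → dot j (prefix m) ≈ sumTo m (λ i → f (suc (j ℕ.+ i)) * inv (m ∸ i))
    dot-prefix zero    j = trans (+-identityʳ _) (reflexive (≡.cong (λ t → f (suc t) * v) (≡.sym (ℕ.+-identityʳ j))))
    dot-prefix (suc m) j = begin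
      f (suc j) * inv (suc m) + dot (suc j) (prefix m)
        ≈⟨ +-congˡ (dot-prefix m (suc j)) ⟩
      f (suc j) * inv (suc m) + sumTo m (λ i → f (suc (suc j ℕ.+ i)) * inv (m ∸ i))
        ≈⟨ +-cong (reflexive (≡.cong (λ t → f (suc t) * inv (suc m)) (≡.sym (ℕ.+-identityʳ j))))
                  (sumTo-cong m (λ i → reflexive (≡.cong (λ t → f (suc t) * inv (m ∸ i)) (≡.sym (ℕ.+-suc j i))))) ⟩
      f (suc (j ℕ.+ 0)) * inv (suc m) + sumTo m (λ i → f (suc (j ℕ.+ suc i)) * inv (m ∸ i))
        ≈⟨ sym (sumTo-unfoldˡ m _) ⟩
      sumTo (suc m) (λ i → f (suc (j ℕ.+ i)) * inv (suc m ∸ i)) ∎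

    ⋆-invSeries : v * f 0 ≈ 1# → ∀ n → (f ⋆ invSeries v f) n ≈ one n
    ⋆-invSeries vf₀≈1 zero    = trans (*-comm _ _) vf₀≈1
    ⋆-invSeries vf₀≈1 (suc m) = begin
      (f ⋆ inv) (suc m)                  ≈⟨ sumTo-unfoldˡ m _ ⟩
      f 0 * (- (v * dot 0 (prefix m))) + Σ ≈⟨ +-congʳ (*-congˡ (-‿cong (*-congˡ (dot-prefix m 0)))) ⟩
      f 0 * (- (v * Σ)) + Σ              ≈⟨ +-congʳ (solve 3 (λ F V S → F :* (:- (V :* S)) := :- ((V :* F) :* S)) refl _ _ _) ⟩
      - ((v * f 0) * Σ) + Σ              ≈⟨ +-congʳ (-‿cong (trans (*-congʳ vf₀≈1) (*-identityˡ _))) ⟩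
      - Σ + Σ                            ≈⟨ -‿inverseˡ _ ⟩
      0#                                 ∎
      where Σ = sumTo m (λ i → f (suc i) * inv (m ∸ i))

  ⋆-cancelˡ : ∀ (D g h : PowerSeries) {v} → v * D 0 ≈ 1# →
              (∀ n → (D ⋆ g) n ≈ (D ⋆ h) n) → ∀ n → g n ≈ h n
  ⋆-cancelˡ D g h {v} vD₀≈1 D⋆g≈D⋆h = <-rec (λ n → g n ≈ h n) step
    where
    step : ∀ n → (∀ {m} → m < n → g m ≈ h m) → g n ≈ h n
    step zero    _       = unit-cancelˡ vD₀≈1 (D⋆g≈D⋆h 0)
    step (suc n) g≈h<n = unit-cancelˡ vD₀≈1 (+-cancelʳ (tail h) _ _ (begin
      D 0 * g (suc n) + tail h   ≈⟨ +-congˡ (sym tail-g≈tail-h) ⟩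
      D 0 * g (suc n) + tail g   ≈⟨ sym (sumTo-unfoldˡ n _) ⟩
      (D ⋆ g) (suc n)            ≈⟨ D⋆g≈D⋆h (suc n) ⟩
      (D ⋆ h) (suc n)            ≈⟨ sumTo-unfoldˡ n _ ⟩
      D 0 * h (suc n) + tail h   ∎))
      where
      tail : PowerSeries → Carrier
      tail f = sumTo n (λ i → D (suc i) * f (n ∸ i))

      tail-g≈tail-h : tail g ≈ tail h
      tail-g≈tail-h = sumTo-cong n (λ i → *-congˡ (g≈h<n (s≤s (ℕ.m∸n≤m n i))))

  ∂ : PowerSeries → PowerSeries
  ∂ f n = fromℕ (suc n) * f (suc n)

  ∂-⋆ : ∀ (f g : PowerSeries) n → ∂ (f ⋆ g) n ≈ (∂ f ⋆ g) n + (f ⋆ ∂ g) n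
  ∂-⋆ f g n = begin
    fromℕ (suc n) * (f ⋆ g) (suc n)
      ≈⟨ *-distribˡ-sumTo (suc n) _ _ ⟩
    sumTo (suc n) (λ i → fromℕ (suc n) * (f i * g (suc n ∸ i)))
      ≈⟨ sumTo-cong-≤ (suc n) (λ i i≤1+n → trans (*-congʳ (split i i≤1+n))
           (solve 4 (λ I J F G → (I :+ J) :* (F :* G) := (I :* F) :* G :+ F :* (J :* G)) refl _ _ _ _)) ⟩
    sumTo (suc n) (λ i → (fromℕ i * f i) * g (suc n ∸ i) + f i * (fromℕ (suc n ∸ i) * g (suc n ∸ i)))
      ≈⟨ sumTo-+ (suc n) _ _ ⟩
    sumTo (suc n) (λ i → (fromℕ i * f i) * g (suc n ∸ i)) + sumTo (suc n) (λ i → f i * (fromℕ (suc n ∸ i) * g (suc n ∸ i)))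
      ≈⟨ +-cong ∂f-part f∂g-part ⟩
    (∂ f ⋆ g) n + (f ⋆ ∂ g) n ∎
    where
    split : ∀ i → i ≤ suc n → fromℕ (suc n) ≈ fromℕ i + fromℕ (suc n ∸ i)
    split i i≤1+n = trans (reflexive (≡.cong fromℕ (≡.sym (ℕ.m+[n∸m]≡n i≤1+n)))) (fromℕ-+ i (suc n ∸ i))

    ∂f-part : sumTo (suc n) (λ i → (fromℕ i * f i) * g (suc n ∸ i)) ≈ (∂ f ⋆ g) n
    ∂f-part = trans (sumTo-unfoldˡ n _) (trans (+-congʳ (trans (*-congʳ (zeroˡ _)) (zeroˡ _))) (+-identityˡ _))

    f∂g-part : sumTo (suc n) (λ i → f i * (fromℕ (suc n ∸ i) * g (suc n ∸ i))) ≈ (f ⋆ ∂ g) n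
    f∂g-part = begin
      sumTo (suc n) (λ i → f i * (fromℕ (suc n ∸ i) * g (suc n ∸ i)))
        ≈⟨ sumTo-suc-∸ n (λ i j → f i * (fromℕ j * g j)) ⟩
      (f ⋆ ∂ g) n + f (suc n) * (0# * g 0)  ≈⟨ +-congˡ (trans (*-congˡ (zeroˡ _)) (zeroʳ _)) ⟩
      (f ⋆ ∂ g) n + 0#                      ≈⟨ +-identityʳ _ ⟩
      (f ⋆ ∂ g) n                           ∎

  ∂-Eigen : Carrier → PowerSeries → Set ℓ
  ∂-Eigen γ f = ∀ n → ∂ f n ≈ γ * f n

  ∂-Eigen-⋆ : ∀ {f g : PowerSeries} α β → ∂-Eigen α f → ∂-Eigen β g → ∂-Eigen (α + β) (f ⋆ g)
  ∂-Eigen-⋆ {f} {g} α β ∂f≈αf ∂g≈βg n = begin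
    ∂ (f ⋆ g) n                                        ≈⟨ ∂-⋆ f g n ⟩
    (∂ f ⋆ g) n + (f ⋆ ∂ g) n                          ≈⟨ +-cong (⋆-congˡ g ∂f≈αf n) (⋆-congʳ f ∂g≈βg n) ⟩
    ((λ j → α * f j) ⋆ g) n + (f ⋆ (λ j → β * g j)) n  ≈⟨ +-cong (⋆-*ˡ f g α n) (⋆-*ʳ f g β n) ⟩
    α * (f ⋆ g) n + β * (f ⋆ g) n                      ≈⟨ sym (distribʳ _ _ _) ⟩
    (α + β) * (f ⋆ g) n                                ∎

  ∂-Eigen-unique : (ι : ℕ → Carrier) → (∀ n → ι n * fromℕ (suc n) ≈ 1#) →
                   ∀ {f g : PowerSeries} γ → ∂-Eigen γ f → ∂-Eigen γ g → f 0 ≈ g 0 → ∀ n → f n ≈ g n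
  ∂-Eigen-unique ι ι-inverse γ ∂f≈γf ∂g≈γg f₀≈g₀ zero    = f₀≈g₀
  ∂-Eigen-unique ι ι-inverse γ ∂f≈γf ∂g≈γg f₀≈g₀ (suc n) = unit-cancelˡ (ι-inverse n)
    (trans (∂f≈γf n) (trans (*-congˡ (∂-Eigen-unique ι ι-inverse γ ∂f≈γf ∂g≈γg f₀≈g₀ n)) (sym (∂g≈γg n))))

  X-⋆ : ∀ (f : PowerSeries) n → (X ⋆ f) n ≈ shift f n
  X-⋆ f zero    = zeroˡ _
  X-⋆ f (suc n) = begin
    (X ⋆ f) (suc n)                                     ≈⟨ sumTo-unfoldˡ n _ ⟩
    0# * f (suc n) + sumTo n (λ i → X (suc i) * f (n ∸ i)) ≈⟨ +-cong (zeroˡ _) (⋆-congˡ f X-suc≈one n) ⟩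
    0# + (one ⋆ f) n                                    ≈⟨ trans (+-identityˡ _) (⋆-identityˡ f n) ⟩
    f n                                                 ∎
    where
    X-suc≈one : ∀ i → X (suc i) ≈ one i
    X-suc≈one zero    = refl
    X-suc≈one (suc i) = refl

  ⋆-shift-invSeries : ∀ {v} (f : PowerSeries) → v * f 0 ≈ 1# → ∀ n → (f ⋆ shift (invSeries v f)) n ≈ X n
  ⋆-shift-invSeries {v} f vf₀≈1 n = trans (⋆-shift f (invSeries v f) n) (shift-one n)
    where
    shift-one : ∀ n → shift (f ⋆ invSeries v f) n ≈ X n
    shift-one zero          = refl
    shift-one (suc zero)    = ⋆-invSeries v f vf₀≈1 0
    shift-one (suc (suc n)) = ⋆-invSeries v f vf₀≈1 (suc n)

module FiniteDifferences {a ℓ} (R : CommutativeRing a ℓ) where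
  open CommutativeRing R hiding (zero)
  open Series R
  open Arithmetic R
  open RawSemiringDefinitions (CommutativeSemiring.rawSemiring commutativeSemiring) using (_^_)

  ΔR : (ℕ → Carrier) → (ℕ → Carrier)
  ΔR f x = f (suc x) - f x

  ΔR^ : ℕ → (ℕ → Carrier) → (ℕ → Carrier)
  ΔR^ zero    f = f
  ΔR^ (suc k) f = ΔR (ΔR^ k f)

  ΔR^-cong : ∀ k {f g : ℕ → Carrier} → (∀ x → f x ≈ g x) → ∀ x → ΔR^ k f x ≈ ΔR^ k g x
  ΔR^-cong zero    f≈g x = f≈g x
  ΔR^-cong (suc k) f≈g x = +-cong (ΔR^-cong k f≈g (suc x)) (-‿cong (ΔR^-cong k f≈g x))

  ΔR^-shift : ∀ k (f : ℕ → Carrier) x → ΔR^ k f (suc x) ≡ ΔR^ k (λ y → f (suc y)) x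
  ΔR^-shift zero    f x = ≡.refl
  ΔR^-shift (suc k) f x = ≡.cong₂ _-_ (ΔR^-shift k f (suc x)) (ΔR^-shift k f x)

  ΔR^-+ : ∀ k (f g : ℕ → Carrier) x → ΔR^ k (λ y → f y + g y) x ≈ ΔR^ k f x + ΔR^ k g x
  ΔR^-+ zero    f g x = refl
  ΔR^-+ (suc k) f g x = trans (+-cong (ΔR^-+ k f g (suc x)) (-‿cong (ΔR^-+ k f g x)))
    (solve 4 (λ a b c d → (a :+ b) :- (c :+ d) := (a :- c) :+ (b :- d)) refl _ _ _ _)

  ΔR^-*ˡ : ∀ k (c : Carrier) (f : ℕ → Carrier) x → ΔR^ k (λ y → c * f y) x ≈ c * ΔR^ k f x
  ΔR^-*ˡ zero    c f x = refl
  ΔR^-*ˡ (suc k) c f x = trans (+-cong (ΔR^-*ˡ k c f (suc x)) (-‿cong (ΔR^-*ˡ k c f x)))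
    (solve 3 (λ c a b → c :* a :- c :* b := c :* (a :- b)) refl _ _ _)

  ΔR^-sumTo : ∀ k n (G : ℕ → ℕ → Carrier) x →
              ΔR^ k (λ y → sumTo n (λ i → G i y)) x ≈ sumTo n (λ i → ΔR^ k (G i) x)
  ΔR^-sumTo k zero    G x = refl
  ΔR^-sumTo k (suc n) G x =
    trans (ΔR^-+ k (λ y → sumTo n (λ i → G i y)) (G (suc n)) x) (+-congʳ (ΔR^-sumTo k n G x))

  ΔR^-const : ∀ k (c : Carrier) x → ΔR^ (suc k) (λ _ → c) x ≈ 0#
  ΔR^-const zero    c x = -‿inverseʳ c
  ΔR^-const (suc k) c x = trans (+-cong (ΔR^-const k c (suc x)) (-‿cong (ΔR^-const k c x)))
    (trans (+-congˡ -0#≈0#) (+-identityʳ _))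

  ΔR^-suc+ΔR^ : ∀ k (f : ℕ → Carrier) x → ΔR^ (suc k) f x + ΔR^ k f x ≈ ΔR^ k f (suc x)
  ΔR^-suc+ΔR^ k f x = solve 2 (λ a b → (a :- b) :+ b := a) refl _ _

  fromℤ-Δ^ : ∀ k (f : ℕ → ℤ) x → fromℤ (Δ^ k f x) ≈ ΔR^ k (λ y → fromℤ (f y)) x
  fromℤ-Δ^ zero    f x = refl
  fromℤ-Δ^ (suc k) f x = trans (fromℤ-+ (Δ^ k f (suc x)) (ℤ.- Δ^ k f x))
    (+-cong (fromℤ-Δ^ k f (suc x)) (trans (fromℤ-neg (Δ^ k f x)) (-‿cong (fromℤ-Δ^ k f x))))

  ΔR^-leibniz : ∀ k (f : ℕ → Carrier) x →
    ΔR^ (suc k) (λ y → fromℕ y * f y) x ≈ fromℕ x * ΔR^ (suc k) f x + fromℕ (suc k) * ΔR^ k f (suc x)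
  ΔR^-leibniz zero f x = begin
    (1# + fromℕ x) * f (suc x) - fromℕ x * f x
      ≈⟨ solve 4 (λ o y a b → (o :+ y) :* a :- y :* b := y :* (a :- b) :+ o :* a) refl 1# _ _ _ ⟩
    fromℕ x * (f (suc x) - f x) + 1# * f (suc x)         ≈⟨ +-congˡ (*-congʳ (sym (+-identityʳ _))) ⟩
    fromℕ x * (f (suc x) - f x) + (1# + 0#) * f (suc x)  ∎
  ΔR^-leibniz (suc k) f x = begin
    ΔR^ (suc k) (λ y → fromℕ y * f y) (suc x) - ΔR^ (suc k) (λ y → fromℕ y * f y) x
      ≈⟨ +-cong (ΔR^-leibniz k f (suc x)) (-‿cong (ΔR^-leibniz k f x)) ⟩
    ((1# + N) * (B₂ - B₁) + K * B₂) - (N * A + K * B₁)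
      ≈⟨ solve 6 (λ o N K A B₁ B₂ → ((o :+ N) :* (B₂ :- B₁) :+ K :* B₂) :- (N :* A :+ K :* B₁)
                   := N :* ((B₂ :- B₁) :- A) :+ (o :+ K) :* (B₂ :- B₁)) refl 1# N K A B₁ B₂ ⟩
    N * ((B₂ - B₁) - A) + (1# + K) * (B₂ - B₁) ∎
    where
    N  = fromℕ x
    K  = fromℕ (suc k)
    A  = ΔR^ (suc k) f x
    B₁ = ΔR^ k f (suc x)
    B₂ = ΔR^ k f (suc (suc x))

  ΔR^k0^n : ℕ → ℕ → Carrier
  ΔR^k0^n k n = ΔR^ k (λ x → fromℕ x ^ n) 0

  fromℤ-Δ^k0^n : ∀ k n → fromℤ (Δ^k0^n k n) ≈ ΔR^k0^n k n
  fromℤ-Δ^k0^n k n = trans (fromℤ-Δ^ k (λ x → + (x ℕ.^ n)) 0) (ΔR^-cong k (λ x → fromℕ-^ x n) 0)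
    where
    fromℕ-^ : ∀ x n → fromℕ (x ℕ.^ n) ≈ fromℕ x ^ n
    fromℕ-^ x zero    = +-identityʳ _
    fromℕ-^ x (suc n) = trans (fromℕ-* x (x ℕ.^ n)) (*-congˡ (fromℕ-^ x n))

  ΔR^k0^n-recurrence : ∀ k n → ΔR^k0^n (suc k) (suc n) ≈ fromℕ (suc k) * (ΔR^k0^n (suc k) n + ΔR^k0^n k n)
  ΔR^k0^n-recurrence k n = begin
    ΔR^k0^n (suc k) (suc n)                                 ≈⟨ ΔR^-leibniz k (λ x → fromℕ x ^ n) 0 ⟩
    0# * ΔR^k0^n (suc k) n + fromℕ (suc k) * ΔR^ k xⁿ 1      ≈⟨ trans (+-congʳ (zeroˡ _)) (+-identityˡ _) ⟩
    fromℕ (suc k) * ΔR^ k xⁿ 1                               ≈⟨ *-congˡ (sym (ΔR^-suc+ΔR^ k xⁿ 0)) ⟩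
    fromℕ (suc k) * (ΔR^k0^n (suc k) n + ΔR^k0^n k n)       ∎
    where
    xⁿ : ℕ → Carrier
    xⁿ x = fromℕ x ^ n

  ΔR^k0^n-vanish : ∀ n k → n < k → ΔR^k0^n k n ≈ 0#
  ΔR^k0^n-vanish zero    (suc k) _           = ΔR^-const k 1# 0
  ΔR^k0^n-vanish (suc n) (suc k) (s≤s n<k) = begin
    ΔR^k0^n (suc k) (suc n)                           ≈⟨ ΔR^k0^n-recurrence k n ⟩
    fromℕ (suc k) * (ΔR^k0^n (suc k) n + ΔR^k0^n k n) ≈⟨ *-congˡ (+-cong (ΔR^k0^n-vanish n (suc k) (ℕ.m≤n⇒m≤1+n n<k))
                                                                       (ΔR^k0^n-vanish n k n<k)) ⟩
    fromℕ (suc k) * (0# + 0#)                         ≈⟨ trans (*-congˡ (+-identityˡ _)) (zeroʳ _) ⟩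
    0#                                                ∎

module Umbral {a ℓ} (R : CommutativeRing a ℓ) (ι : ℕ → CommutativeRing.Carrier R)
  (ι-inverse : ∀ n → CommutativeRing._≈_ R (CommutativeRing._*_ R (ι n) (Series.fromℕ R (suc n))) (CommutativeRing.1# R))
  (c u : CommutativeRing.Carrier R) where
  open CommutativeRing R hiding (zero)
  open Series R
  open Arithmetic R
  open Sums R
  open PowerSeriesAlgebra R
  open FiniteDifferences R
  open RawSemiringDefinitions (CommutativeSemiring.rawSemiring commutativeSemiring) using (_^_)
  open Todd c u ι

  expNegTimes : ℕ → PowerSeries
  expNegTimes x n = sign n * invFact n * fromℕ x ^ n

  expNeg-∂-Eigen : ∂-Eigen (- 1#) expNeg
  expNeg-∂-Eigen n = begin
    fromℕ (suc n) * (- sign n * (invFact n * ι n))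
      ≈⟨ solve 4 (λ N s I j → N :* ((:- s) :* (I :* j)) := (j :* N) :* (:- (s :* I))) refl _ _ _ _ ⟩
    (ι n * fromℕ (suc n)) * (- expNeg n)  ≈⟨ trans (*-congʳ (ι-inverse n)) (*-identityˡ _) ⟩
    - expNeg n                            ≈⟨ -‿cong (sym (*-identityˡ _)) ⟩
    - (1# * expNeg n)                     ≈⟨ -‿distribˡ-* _ _ ⟩
    (- 1#) * expNeg n                     ∎

  expNegTimes-∂-Eigen : ∀ x → ∂-Eigen (- fromℕ x) (expNegTimes x)
  expNegTimes-∂-Eigen x n = begin
    fromℕ (suc n) * (- sign n * (invFact n * ι n) * (fromℕ x * fromℕ x ^ n))
      ≈⟨ solve 6 (λ N s I j y P → N :* ((:- s) :* (I :* j) :* (y :* P)) := (j :* N) :* ((:- y) :* (s :* I :* P)))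
                 refl _ _ _ _ _ _ ⟩
    (ι n * fromℕ (suc n)) * ((- fromℕ x) * expNegTimes x n)  ≈⟨ trans (*-congʳ (ι-inverse n)) (*-identityˡ _) ⟩
    (- fromℕ x) * expNegTimes x n                            ∎

  -- Both sides solve f′ = −(x+1) f with f(0) = 1.
  expNegTimes-suc : ∀ x n → expNegTimes (suc x) n ≈ (expNeg ⋆ expNegTimes x) n
  expNegTimes-suc x = ∂-Eigen-unique ι ι-inverse (- (1# + fromℕ x)) (expNegTimes-∂-Eigen (suc x))
    (λ n → trans (∂-Eigen-⋆ (- 1#) (- fromℕ x) expNeg-∂-Eigen (expNegTimes-∂-Eigen x) n) (*-congʳ (-‿+-comm _ _)))
    (trans 1³≈1 (sym (trans (*-cong (*-identityʳ _) 1³≈1) (*-identityʳ _))))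
    where
    1³≈1 : 1# * 1# * 1# ≈ 1#
    1³≈1 = trans (*-identityʳ _) (*-identityʳ _)

  umbral : ℕ → PowerSeries
  umbral k n = sign n * invFact n * ΔR^k0^n k n

  ΔR^-expNegTimes : ∀ k n → ΔR^ k (λ x → expNegTimes x n) 0 ≈ umbral k n
  ΔR^-expNegTimes k n = ΔR^-*ˡ k (sign n * invFact n) (λ x → fromℕ x ^ n) 0

  expNeg-⋆-umbral : ∀ k n → (expNeg ⋆ umbral k) n ≈ umbral (suc k) n + umbral k n
  expNeg-⋆-umbral k n = begin
    sumTo n (λ i → expNeg i * umbral k (n ∸ i))
      ≈⟨ sumTo-cong n (λ i → sym (trans (ΔR^-*ˡ k (expNeg i) (λ x → expNegTimes x (n ∸ i)) 0)
                                         (*-congˡ (ΔR^-expNegTimes k (n ∸ i))))) ⟩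
    sumTo n (λ i → ΔR^ k (λ x → expNeg i * expNegTimes x (n ∸ i)) 0)
      ≈⟨ sym (ΔR^-sumTo k n (λ i x → expNeg i * expNegTimes x (n ∸ i)) 0) ⟩
    ΔR^ k (λ x → (expNeg ⋆ expNegTimes x) n) 0
      ≈⟨ sym (ΔR^-cong k (λ x → expNegTimes-suc x n) 0) ⟩
    ΔR^ k (λ x → expNegTimes (suc x) n) 0
      ≡⟨ ΔR^-shift k (λ x → expNegTimes x n) 0 ⟨
    ΔR^ k (λ x → expNegTimes x n) 1
      ≈⟨ sym (ΔR^-suc+ΔR^ k _ 0) ⟩
    ΔR^ (suc k) (λ x → expNegTimes x n) 0 + ΔR^ k (λ x → expNegTimes x n) 0
      ≈⟨ +-cong (ΔR^-expNegTimes (suc k) n) (ΔR^-expNegTimes k n) ⟩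
    umbral (suc k) n + umbral k n ∎

  umbral-vanish : ∀ n k → n < k → umbral k n ≈ 0#
  umbral-vanish n k n<k = trans (*-congˡ (ΔR^k0^n-vanish n k n<k)) (zeroʳ _)

  logSeries-newton : ∀ m → sumTo m (λ k → logSeries k * ΔR^k0^n k m) ≈ X m
  logSeries-newton zero    = zeroˡ _
  logSeries-newton (suc n) = begin
    sumTo (suc n) (λ k → logSeries k * ΔR^k0^n k (suc n))
      ≈⟨ sumTo-unfoldˡ n _ ⟩
    0# * ΔR^k0^n 0 (suc n) + sumTo n (λ k → (sign k * ι k) * ΔR^k0^n (suc k) (suc n))
      ≈⟨ +-cong (zeroˡ _) (sumTo-cong n term) ⟩
    0# + sumTo n (λ k → sign k * (ΔR^k0^n (suc k) n + ΔR^k0^n k n))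
      ≈⟨ +-identityˡ _ ⟩
    sumTo n (λ k → sign k * (ΔR^k0^n (suc k) n + ΔR^k0^n k n))
      ≈⟨ sumTo-alternating-telescope n (λ j → ΔR^k0^n j n) ⟩
    ΔR^k0^n 0 n + sign n * ΔR^k0^n (suc n) n
      ≈⟨ +-congˡ (trans (*-congˡ (ΔR^k0^n-vanish n (suc n) ℕ.≤-refl)) (zeroʳ _)) ⟩
    ΔR^k0^n 0 n + 0#
      ≈⟨ trans (+-identityʳ _) (Δ⁰0^n n) ⟩
    X (suc n) ∎
    where
    term : ∀ k → (sign k * ι k) * ΔR^k0^n (suc k) (suc n) ≈ sign k * (ΔR^k0^n (suc k) n + ΔR^k0^n k n)
    term k = begin
      (sign k * ι k) * ΔR^k0^n (suc k) (suc n)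
        ≈⟨ *-congˡ (ΔR^k0^n-recurrence k n) ⟩
      (sign k * ι k) * (fromℕ (suc k) * (ΔR^k0^n (suc k) n + ΔR^k0^n k n))
        ≈⟨ solve 4 (λ s j K A → (s :* j) :* (K :* A) := (j :* K) :* (s :* A)) refl _ _ _ _ ⟩
      (ι k * fromℕ (suc k)) * (sign k * (ΔR^k0^n (suc k) n + ΔR^k0^n k n))
        ≈⟨ trans (*-congʳ (ι-inverse k)) (*-identityˡ _) ⟩
      sign k * (ΔR^k0^n (suc k) n + ΔR^k0^n k n) ∎

    Δ⁰0^n : ∀ n → ΔR^k0^n 0 n ≈ X (suc n)
    Δ⁰0^n zero    = refl
    Δ⁰0^n (suc n) = zeroˡ _

  logSeries-umbral : ∀ m → sumTo m (λ k → logSeries k * umbral k m) ≈ - X m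
  logSeries-umbral m = begin
    sumTo m (λ k → logSeries k * umbral k m)
      ≈⟨ sumTo-cong m (λ k → solve 3 (λ L S D → L :* (S :* D) := S :* (L :* D)) refl _ _ _) ⟩
    sumTo m (λ k → (sign m * invFact m) * (logSeries k * ΔR^k0^n k m))
      ≈⟨ sym (*-distribˡ-sumTo m _ _) ⟩
    sign m * invFact m * sumTo m (λ k → logSeries k * ΔR^k0^n k m)
      ≈⟨ *-congˡ (logSeries-newton m) ⟩
    sign m * invFact m * X m
      ≈⟨ signed-X m ⟩
    - X m ∎
    where
    ι₀≈1 : ι 0 ≈ 1#
    ι₀≈1 = trans (sym (*-identityʳ _)) (trans (*-congˡ (sym (+-identityʳ _))) (ι-inverse 0))

    signed-X : ∀ m → sign m * invFact m * X m ≈ - X m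
    signed-X zero          = trans (zeroʳ _) (sym -0#≈0#)
    signed-X (suc zero)    = trans (*-identityʳ _) (trans (*-congˡ (trans (*-identityˡ _) ι₀≈1)) (*-identityʳ _))
    signed-X (suc (suc m)) = trans (zeroʳ _) (sym -0#≈0#)

  pDen-⋆ : ∀ (h : PowerSeries) k → (pDen ⋆ h) k ≈ (c - 1#) * h k + c * shift h k
  pDen-⋆ h zero    = sym (trans (+-congˡ (zeroʳ _)) (+-identityʳ _))
  pDen-⋆ h (suc k) = trans (sumTo-unfoldˡ k _) (+-congˡ (tail k))
    where
    tail : ∀ k → sumTo k (λ i → pDen (suc i) * h (k ∸ i)) ≈ c * h k
    tail zero    = refl
    tail (suc k) = trans (sumTo-unfoldˡ k _) (trans (+-congˡ (sumTo-zero k _ (λ i → zeroˡ _))) (+-identityʳ _))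

  p-recurrence : u * (1# - c) ≈ 1# → ∀ k → (c - 1#) * p k + c * shift p k ≈ logSeries k
  p-recurrence u-inverse k = begin
    (c - 1#) * p k + c * shift p k
      ≈⟨ +-congˡ (*-congˡ (sym (⋆-shift logSeries pDen⁻¹ k))) ⟩
    (c - 1#) * (logSeries ⋆ pDen⁻¹) k + c * (logSeries ⋆ shift pDen⁻¹) k
      ≈⟨ sym (⋆-linearʳ logSeries pDen⁻¹ (shift pDen⁻¹) (c - 1#) c k) ⟩
    (logSeries ⋆ (λ j → (c - 1#) * pDen⁻¹ j + c * shift pDen⁻¹ j)) k
      ≈⟨ ⋆-congʳ logSeries (λ j → trans (sym (pDen-⋆ pDen⁻¹ j)) (⋆-invSeries (- u) pDen -u-inverse j)) k ⟩
    (logSeries ⋆ one) k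
      ≈⟨ ⋆-identityʳ logSeries k ⟩
    logSeries k ∎
    where
    pDen⁻¹ : PowerSeries
    pDen⁻¹ = invSeries (- u) pDen

    -u-inverse : - u * (c - 1#) ≈ 1#
    -u-inverse = trans (solve 3 (λ U C O → (:- U) :* (C :- O) := U :* (O :- C)) refl u c 1#) u-inverse

  umbralSum : PowerSeries
  umbralSum n = sumTo n (λ k → p k * umbral k n)

  rhsSeries≈umbralSum : ∀ n → rhsSeries n ≈ umbralSum n
  rhsSeries≈umbralSum n = begin
    sign n * invFact n * sumTo n (λ k → p k * fromℤ (Δ^k0^n k n))
      ≈⟨ *-congˡ (sumTo-cong n (λ k → *-congˡ (fromℤ-Δ^k0^n k n))) ⟩
    sign n * invFact n * sumTo n (λ k → p k * ΔR^k0^n k n)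
      ≈⟨ *-distribˡ-sumTo n _ _ ⟩
    sumTo n (λ k → (sign n * invFact n) * (p k * ΔR^k0^n k n))
      ≈⟨ sumTo-cong n (λ k → solve 3 (λ A P D → A :* (P :* D) := P :* (A :* D)) refl _ _ _) ⟩
    umbralSum n ∎

  expNeg-⋆-umbralSum : ∀ n → (expNeg ⋆ umbralSum) n ≈ sumTo n (λ k → p k * (expNeg ⋆ umbral k) n)
  expNeg-⋆-umbralSum n = begin
    sumTo n (λ i → expNeg i * sumTo (n ∸ i) (λ k → p k * umbral k (n ∸ i)))
      ≈⟨ sumTo-cong n (λ i → *-congˡ (sumTo-extend (n ∸ i) n _ (ℕ.m∸n≤m n i)
            (λ k n∸i<k → trans (*-congˡ (umbral-vanish (n ∸ i) k n∸i<k)) (zeroʳ _)))) ⟩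
    sumTo n (λ i → expNeg i * sumTo n (λ k → p k * umbral k (n ∸ i)))
      ≈⟨ sumTo-cong n (λ i → *-distribˡ-sumTo n _ _) ⟩
    sumTo n (λ i → sumTo n (λ k → expNeg i * (p k * umbral k (n ∸ i))))
      ≈⟨ sumTo-swap n n _ ⟩
    sumTo n (λ k → sumTo n (λ i → expNeg i * (p k * umbral k (n ∸ i))))
      ≈⟨ sumTo-cong n (λ k → sumTo-cong n (λ i → solve 3 (λ E P G → E :* (P :* G) := P :* (E :* G)) refl _ _ _)) ⟩
    sumTo n (λ k → sumTo n (λ i → p k * (expNeg i * umbral k (n ∸ i))))
      ≈⟨ sumTo-cong n (λ k → sym (*-distribˡ-sumTo n _ _)) ⟩
    sumTo n (λ k → p k * (expNeg ⋆ umbral k) n) ∎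

  sumTo-p-umbral-suc : ∀ n → sumTo n (λ k → p k * umbral (suc k) n) ≈ sumTo n (λ k → shift p k * umbral k n)
  sumTo-p-umbral-suc zero    = trans (trans (*-congˡ (umbral-vanish 0 1 (s≤s z≤n))) (zeroʳ _)) (sym (zeroˡ _))
  sumTo-p-umbral-suc (suc n) = begin
    sumTo n (λ k → p k * umbral (suc k) (suc n)) + p (suc n) * umbral (suc (suc n)) (suc n)
      ≈⟨ +-congˡ (trans (*-congˡ (umbral-vanish (suc n) (suc (suc n)) ℕ.≤-refl)) (zeroʳ _)) ⟩
    sumTo n (λ k → p k * umbral (suc k) (suc n)) + 0#
      ≈⟨ trans (+-identityʳ _) (sym (trans (+-congʳ (zeroˡ _)) (+-identityˡ _))) ⟩
    0# * umbral 0 (suc n) + sumTo n (λ k → p k * umbral (suc k) (suc n))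
      ≈⟨ sym (sumTo-unfoldˡ n _) ⟩
    sumTo (suc n) (λ k → shift p k * umbral k (suc n)) ∎

  pDen-umbralSum : u * (1# - c) ≈ 1# → ∀ n →
    (c - 1#) * umbralSum n + c * sumTo n (λ k → shift p k * umbral k n) ≈ - X n
  pDen-umbralSum u-inverse n = begin
    (c - 1#) * umbralSum n + c * sumTo n (λ k → shift p k * umbral k n)
      ≈⟨ +-cong (*-distribˡ-sumTo n _ _) (*-distribˡ-sumTo n _ _) ⟩
    sumTo n (λ k → (c - 1#) * (p k * umbral k n)) + sumTo n (λ k → c * (shift p k * umbral k n))
      ≈⟨ sym (sumTo-+ n _ _) ⟩
    sumTo n (λ k → (c - 1#) * (p k * umbral k n) + c * (shift p k * umbral k n))
      ≈⟨ sumTo-cong n (λ k → trans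
           (solve 5 (λ A P B Q G → A :* (P :* G) :+ B :* (Q :* G) := (A :* P :+ B :* Q) :* G) refl _ _ _ _ _)
           (*-congʳ (p-recurrence u-inverse k))) ⟩
    sumTo n (λ k → logSeries k * umbral k n)
      ≈⟨ logSeries-umbral n ⟩
    - X n ∎

  toddDen-⋆-umbralSum : u * (1# - c) ≈ 1# → ∀ n → (toddDen ⋆ umbralSum) n ≈ X n
  toddDen-⋆-umbralSum u-inverse n = begin
    (toddDen ⋆ umbralSum) n
      ≈⟨ ⋆-congˡ umbralSum toddDen-expand n ⟩
    ((λ j → 1# * one j + (- c) * expNeg j) ⋆ umbralSum) n
      ≈⟨ ⋆-linearˡ umbralSum one expNeg 1# (- c) n ⟩
    1# * (one ⋆ umbralSum) n + (- c) * (expNeg ⋆ umbralSum) n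
      ≈⟨ +-cong (*-congˡ (⋆-identityˡ umbralSum n)) (*-congˡ (expNeg-⋆-umbralSum n)) ⟩
    1# * S + (- c) * sumTo n (λ k → p k * (expNeg ⋆ umbral k) n)
      ≈⟨ +-congˡ (*-congˡ (sumTo-cong n (λ k → trans (*-congˡ (expNeg-⋆-umbral k n)) (distribˡ _ _ _)))) ⟩
    1# * S + (- c) * sumTo n (λ k → p k * umbral (suc k) n + p k * umbral k n)
      ≈⟨ +-congˡ (*-congˡ (trans (sumTo-+ n _ _) (+-congʳ (sumTo-p-umbral-suc n)))) ⟩
    1# * S + (- c) * (T + S)
      ≈⟨ solve 4 (λ o c S T → o :* S :+ (:- c) :* (T :+ S) := :- ((c :- o) :* S :+ c :* T)) refl 1# c S T ⟩
    - ((c - 1#) * S + c * T)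
      ≈⟨ -‿cong (pDen-umbralSum u-inverse n) ⟩
    - - X n
      ≈⟨ -‿involutive _ ⟩
    X n ∎
    where
    S = umbralSum n
    T = sumTo n (λ k → shift p k * umbral k n)

    toddDen-expand : ∀ j → toddDen j ≈ 1# * one j + (- c) * expNeg j
    toddDen-expand zero    = sym (+-cong (*-identityʳ 1#) (trans (*-congˡ (*-identityʳ 1#)) (*-identityʳ _)))
    toddDen-expand (suc j) = sym (trans (+-congʳ (zeroʳ _)) (trans (+-identityˡ _) (sym (-‿distribˡ-* _ _))))

mainTheorem2 : ∀ {a ℓ : Level} (R : CommutativeRing a ℓ)
    → (ι : ℕ → CommutativeRing.Carrier R)
    → (∀ n → CommutativeRing._≈_ R (CommutativeRing._*_ R (ι n) (Series.fromℕ R (suc n))) (CommutativeRing.1# R))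
    → (c u : CommutativeRing.Carrier R)
    → CommutativeRing._≈_ R (CommutativeRing._*_ R u (CommutativeRing._-_ R (CommutativeRing.1# R) c)) (CommutativeRing.1# R)
    → ∀ n → CommutativeRing._≈_ R (Series.Todd.toddSeries R c u ι n) (Series.Todd.rhsSeries R c u ι n)
mainTheorem2 R ι ι-inverse c u u-inverse n = begin
  toddSeries n                        ≈⟨ X-⋆ (invSeries u toddDen) n ⟩
  shift (invSeries u toddDen) n       ≈⟨ ⋆-cancelˡ toddDen (shift (invSeries u toddDen)) umbralSum u-inverse toddDen-⋆-both n ⟩
  umbralSum n                         ≈⟨ sym (rhsSeries≈umbralSum n) ⟩
  rhsSeries n                         ∎
  where
  open CommutativeRing R using (_≈_; sym; trans; setoid)
  open import Relation.Binary.Reasoning.Setoid setoid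
  open Series R
  open Todd c u ι
  open PowerSeriesAlgebra R
  open Umbral R ι ι-inverse c u

  toddDen-⋆-both : ∀ m → (toddDen ⋆ shift (invSeries u toddDen)) m ≈ (toddDen ⋆ umbralSum) m
  toddDen-⋆-both m = trans (⋆-shift-invSeries toddDen u-inverse m) (sym (toddDen-⋆-umbralSum u-inverse m))
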